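{- Let $w$ be a pp-irreducible string, let $\mathit{Pals}$ be an array of nonnegative integers indexed by the positions of $w$, and let $c,d$ be positions of $w$. If $c$ is right-good in $w$ (with respect to $\mathit{Pals}$) and $c\sqsubset_w d$, then $d$ is left-good in $w$ (with respect to $\mathit{Pals}$).
   Context: Strings over $\Sigma$, positions $1,\dots,|w|$, $w[i:j]=w[i]\cdots w[j]$, $\overline{x}$ the reverse. Palindromes are even palindromes $x\overline{x}$; for a position $c$, $\rho_w(c)$ is the largest $r\ge 0$ with $c-r\ge0$, $c+r\le|w|$ and $w[c-r+1:c+r]$ a palindrome. A Z-shape is $x\overline{x}x$, $x$ nonempty; a string is irreducible if no Z-shape occurs in it as a substring; $w$ is pp-irreducible if $w[1:|w|-1]$ is irreducible. For a pp-irreducible $w$ and distinct positions $c,d$, write $c\sqsubset_w d$ if $c\le d-\rho_w(d)\le d\le c+\rho_w(c)\le d+\rho_w(d)$. For integers $i,j,k$ write $i\sim_k j$ if $\min\{i,k\}=\min\{j,k\}$. For positions $a\le b$, $\mathit{Pals}$ is accurate enough between $a$ and $b$, written $\mathbf{AE}_w(a,b)$, if $\mathit{Pals}[e]\sim_{b-e}\rho_w(e)$ for every $e\in[a:b]$. Let $\nu_w(c)$ be the largest position $e$ with $e\sqsubset_w c$, or $1$ if no such $e$ exists. A position $c$ is left-good in $w$ if $\mathbf{AE}_w(\nu_w(c),c)$ holds, and right-good in $w$ if $\mathbf{AE}_w(c,c+\rho_w(c))$ holds. -}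

module Defs where

open import Data.Nat using (ℕ; zero; suc; _+_; _∸_; _≤_; _≤?_; _⊓_)
open import Data.Nat.Properties using (_≟_)
open import Data.List using (List; []; _∷_; _++_; length; take; drop; reverse)
open import Data.List.Properties using (≡-dec)
open import Data.Product using (Σ; ∃; _×_; _,_)
open import Relation.Nullary using (¬_; Dec; yes; no)
open import Relation.Nullary.Decidable using (_×-dec_; ¬?)
open import Relation.Binary using (DecidableEquality)
open import Relation.Binary.PropositionalEquality using (_≡_; _≢_)
open import Relation.Unary using (Decidable)

largestOr : ℕ → (P : ℕ → Set) → Decidable P → ℕ → ℕ
largestOr dflt P P? zero = dflt
largestOr dflt P P? (suc n) with P? (suc n)
... | yes _ = suc n
... | no  _ = largestOr dflt P P? n

module _ {A : Set} (_≟A_ : DecidableEquality A) where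

  -- w[i+1 : j]  (positions are 1-based)
  slice : List A → ℕ → ℕ → List A
  slice w i j = take (j ∸ i) (drop i w)

  HasZShape : List A → Set
  HasZShape w = Σ (List A) λ u → Σ (List A) λ v → Σ (List A) λ x →
    (x ≢ []) × (w ≡ u ++ (x ++ (reverse x ++ (x ++ v))))

  Irreducible : List A → Set
  Irreducible w = ¬ HasZShape w

  PPIrreducible : List A → Set
  PPIrreducible w = Irreducible (slice w 0 (length w ∸ 1))

  PalAt : List A → ℕ → ℕ → Set
  PalAt w c r = (r ≤ c) × ((c + r ≤ length w) ×
                (slice w (c ∸ r) (c + r) ≡ slice w (c ∸ r) c ++ reverse (slice w (c ∸ r) c)))

  palAt? : (w : List A) (c : ℕ) → Decidable (PalAt w c)
  palAt? w c r = (r ≤? c) ×-dec ((c + r ≤? length w) ×-dec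
                 ≡-dec _≟A_ (slice w (c ∸ r) (c + r)) (slice w (c ∸ r) c ++ reverse (slice w (c ∸ r) c)))

  -- ρ_w(c): largest r ≥ 0 with PalAt w c r (r ≤ |w| necessarily; r = 0 is the default)
  ρ : List A → ℕ → ℕ
  ρ w c = largestOr 0 (PalAt w c) (palAt? w c) (length w)

  Sqsub : List A → ℕ → ℕ → Set
  Sqsub w c d = (c ≢ d) × ((c ≤ d ∸ ρ w d) × ((d ∸ ρ w d ≤ d) ×
                ((d ≤ c + ρ w c) × (c + ρ w c ≤ d + ρ w d))))

  sqsub? : (w : List A) (d : ℕ) → Decidable (λ c → Sqsub w c d)
  sqsub? w d c = ¬? (c ≟ d) ×-dec ((c ≤? d ∸ ρ w d) ×-dec ((d ∸ ρ w d ≤? d) ×-dec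
                 ((d ≤? c + ρ w c) ×-dec (c + ρ w c ≤? d + ρ w d))))

  SimK : ℕ → ℕ → ℕ → Set
  SimK k i j = i ⊓ k ≡ j ⊓ k

  AE : List A → (ℕ → ℕ) → ℕ → ℕ → Set
  AE w Pals a b = ∀ e → a ≤ e → e ≤ b → SimK (b ∸ e) (Pals e) (ρ w e)

  ν : List A → ℕ → ℕ
  ν w c = largestOr 1 (λ e → Sqsub w e c) (sqsub? w c) (length w)

  LeftGood : List A → (ℕ → ℕ) → ℕ → Set
  LeftGood w Pals c = AE w Pals (ν w c) c

  RightGood : List A → (ℕ → ℕ) → ℕ → Set
  RightGood w Pals c = AE w Pals c (c + ρ w c)

module Submission where

-- Right-goodness of c says that Pals is accurate enough on the
-- interval [c : c + ρ(c)], and left-goodness of d asks for accuracy on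
-- [ν(d) : d].  Accuracy is monotone under shrinking the interval: moving the
-- left end rightwards drops constraints, and moving the right end leftwards
-- only weakens each comparison i ∼_k j (smaller k).  So it suffices that
--   * c ≤ ν(d), since ν(d) is the largest e with e ⊏ d and c is such an e;
--   * d ≤ c + ρ(c), which is one of the defining inequalities of c ⊏ d.

open import Defs
open import Data.Nat using (ℕ; zero; suc; _+_; _∸_; _⊓_; _≤_)
open import Data.Nat.Properties
  using (≤-trans; ≤-pred; 1+n≰n; m≤n⇒m<n∨m≡n; ∸-monoˡ-≤; ⊓-assoc; m≥n⇒m⊓n≡n)
open import Data.List using (List; length)
open import Data.Product using (_,_)
open import Data.Sum using (inj₁; inj₂)
open import Data.Empty using (⊥-elim)
open import Relation.Nullary using (yes; no)
open import Relation.Unary using (Decidable)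
open import Relation.Binary using (DecidableEquality)
open import Relation.Binary.PropositionalEquality using (_≡_; refl; sym; cong; module ≡-Reasoning)

largestOr-maximal : (dflt : ℕ) (P : ℕ → Set) (P? : Decidable P) (n c : ℕ) →
  P c → 1 ≤ c → c ≤ n → c ≤ largestOr dflt P P? n
largestOr-maximal dflt P P? zero    c _  1≤c c≤0 = ⊥-elim (1+n≰n (≤-trans 1≤c c≤0))
largestOr-maximal dflt P P? (suc n) c pc 1≤c c≤n with P? (suc n)
... | yes _ = c≤n
... | no ¬p with m≤n⇒m<n∨m≡n c≤n
...   | inj₁ c<n  = largestOr-maximal dflt P P? n c pc 1≤c (≤-pred c<n)
...   | inj₂ refl = ⊥-elim (¬p pc)

ν-maximal : {A : Set} (_≟A_ : DecidableEquality A) (w : List A) (c d : ℕ) →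
  1 ≤ c → c ≤ length w → Sqsub _≟A_ w c d → c ≤ ν _≟A_ w d
ν-maximal _≟A_ w c d 1≤c c≤n c⊏d =
  largestOr-maximal 1 (λ e → Sqsub _≟A_ w e d) (sqsub? _≟A_ w d) (length w) c c⊏d 1≤c c≤n

SimK-antitone : {k K i j : ℕ} → k ≤ K → i ⊓ K ≡ j ⊓ K → i ⊓ k ≡ j ⊓ k
SimK-antitone {k} {K} {i} {j} k≤K i∼j = begin
  i ⊓ k        ≡⟨ cong (i ⊓_) (sym (m≥n⇒m⊓n≡n k≤K)) ⟩
  i ⊓ (K ⊓ k)  ≡⟨ sym (⊓-assoc i K k) ⟩
  (i ⊓ K) ⊓ k  ≡⟨ cong (_⊓ k) i∼j ⟩
  (j ⊓ K) ⊓ k  ≡⟨ ⊓-assoc j K k ⟩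
  j ⊓ (K ⊓ k)  ≡⟨ cong (j ⊓_) (m≥n⇒m⊓n≡n k≤K) ⟩
  j ⊓ k        ∎
  where open ≡-Reasoning

AE-shrink : {A : Set} (_≟A_ : DecidableEquality A) (w : List A) (Pals : ℕ → ℕ)
  {a a′ b b′ : ℕ} → a ≤ a′ → b′ ≤ b →
  AE _≟A_ w Pals a b → AE _≟A_ w Pals a′ b′
AE-shrink _≟A_ w Pals a≤a′ b′≤b accurate e a′≤e e≤b′ =
  SimK-antitone (∸-monoˡ-≤ e b′≤b)
    (accurate e (≤-trans a≤a′ a′≤e) (≤-trans e≤b′ b′≤b))

-- Lemma 8: right-goodness of c transfers to left-goodness of d when c ⊏_w d,
-- because [ν(d) : d] is a subinterval of [c : c + ρ(c)].
lemma8 : {A : Set} (_≟A_ : DecidableEquality A) (w : List A) (Pals : ℕ → ℕ) (c d : ℕ) →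
    PPIrreducible _≟A_ w →
    1 ≤ c → c ≤ length w → 1 ≤ d → d ≤ length w →
    RightGood _≟A_ w Pals c → Sqsub _≟A_ w c d →
    LeftGood _≟A_ w Pals d
lemma8 _≟A_ w Pals c d _ 1≤c c≤n _ _ rightGood c⊏d@(_ , _ , _ , d≤c+ρc , _) =
  AE-shrink _≟A_ w Pals (ν-maximal _≟A_ w c d 1≤c c≤n c⊏d) d≤c+ρc rightGood
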